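{- Let $N, d, n_0$ be positive integers and let $\{u^{(i)}_n\}$, $1 \le i \le N$, be sequences of real numbers. Suppose that for each $i$ there is a linear function $f^{(i)}:\mathbb{R}^N\to\mathbb{R}$ such that $$u^{(i)}_n = f^{(i)}\bigl(u^{(1)}_{n-1}, u^{(2)}_{n-1}, \dotsc, u^{(N)}_{n-1}\bigr) \quad\text{for all } n \ge n_0 \text{ and all } 1\le i\le N.$$ Let $g:\mathbb{R}^{d+1}\to\mathbb{R}$ be a linear function such that $$g\bigl(u^{(i)}_n, u^{(i)}_{n-1}, \dotsc, u^{(i)}_{n-d}\bigr) = 0$$ holds for some $n = n_1 \ge n_0 + d$ and all $i$ with $1 \le i \le N$. Then $g\bigl(u^{(i)}_n, u^{(i)}_{n-1}, \dotsc, u^{(i)}_{n-d}\bigr) = 0$ holds for all $n \ge n_1$ and all $i$ with $1 \le i \le N$.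
   Context: Here "linear function" means a linear map (homogeneous, no constant term). The sequences are indexed so that all terms appearing are defined. -}

module Defs where

open import Level using (_⊔_)
open import Data.Nat using (ℕ)
open import Data.Fin using (Fin)
open import Data.Product using (_×_)
open import Algebra.Bundles using (CommutativeRing)

-- Besides additivity and homogeneity we require that f respects the
-- ring's (setoid) equality; for the reals (≡) this is automatic.
module _ {c ℓ} (R : CommutativeRing c ℓ) where
  open CommutativeRing R

  IsLinear : (n : ℕ) → ((Fin n → Carrier) → Carrier) → Set (c ⊔ ℓ)
  IsLinear n f =
    (∀ (x y : Fin n → Carrier) → (∀ i → x i ≈ y i) → f x ≈ f y)
    × (∀ (x y : Fin n → Carrier) → f (λ i → x i + y i) ≈ f x + f y)
    × (∀ (a : Carrier) (x : Fin n → Carrier) → f (λ i → a * x i) ≈ a * f x)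

{-# OPTIONS --safe #-}
module Submission where

open import Defs
open import Data.Nat using (ℕ; suc; _≤_; _≤′_; ≤′-refl; ≤′-step; _+_; _∸_)
open import Data.Nat.Properties
  using (≤-trans; n≤1+n; ∸-monoˡ-≤; ∸-monoʳ-≤; m+n≤o⇒m≤o∸n; ∸-+-assoc; +-comm; ≤⇒≤′; ≤′⇒≤)
open import Data.Fin using (Fin; zero; suc; toℕ)
open import Data.Fin.Properties using (toℕ≤pred[n])
open import Data.Product using (_,_; proj₁)
open import Function using (_∘_)
open import Algebra.Bundles using (CommutativeRing)
import Relation.Binary.PropositionalEquality as ≡

-- Linear maps commute: applying f⁽ⁱ⁾ to each column of a matrix and then g gives
-- the same as applying g to each row and then f⁽ⁱ⁾ (expand f⁽ⁱ⁾ in the standard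
-- basis).  Applied to the matrix of windows (u⁽ʲ⁾ₙ, …, u⁽ʲ⁾ₙ₋d), this says that
-- the values of g on the windows at time n + 1 are the f⁽ⁱ⁾ of its values at
-- time n, so vanishing at n₁ propagates to every later n.

n₀≤1+n∸k : ∀ {n₀ d n k} → n₀ + d ≤ n → k ≤ d → n₀ ≤ suc n ∸ k
n₀≤1+n∸k {n₀} {n = n} {k} n₀+d≤n k≤d =
  ≤-trans (m+n≤o⇒m≤o∸n n₀ n₀+d≤n) (≤-trans (∸-monoʳ-≤ n k≤d) (∸-monoˡ-≤ k (n≤1+n n)))

[1+n∸k]∸1≡n∸k : ∀ n k → suc n ∸ k ∸ 1 ≡.≡ n ∸ k
[1+n∸k]∸1≡n∸k n k = ≡.trans (∸-+-assoc (suc n) k 1) (≡.cong (suc n ∸_) (+-comm k 1))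

module _ {c ℓ} (R : CommutativeRing c ℓ) where
  open CommutativeRing R hiding (zero) renaming (_+_ to _+ᴿ_)
  open import Algebra.Properties.Semiring.Sum semiring using (sum-syntax; sum-cong-≋; sum-replicate-zero)
  open import Relation.Binary.Reasoning.Setoid setoid

  linear-zero : ∀ {m h} → IsLinear R m h → h (λ _ → 0#) ≈ 0#
  linear-zero {h = h} (h-cong , _ , homogeneous) = begin
    h (λ _ → 0#)      ≈⟨ h-cong _ _ (λ _ → zeroˡ 0#) ⟨
    h (λ _ → 0# * 0#) ≈⟨ homogeneous 0# (λ _ → 0#) ⟩
    0# * h (λ _ → 0#) ≈⟨ zeroˡ _ ⟩
    0#                ∎

  linear-sum : ∀ {m h} → IsLinear R m h → ∀ {n} (a : Fin n → Fin m → Carrier) →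
               h (λ k → ∑[ j < n ] a j k) ≈ ∑[ j < n ] h (a j)
  linear-sum L {0} a = linear-zero L
  linear-sum L@(_ , additive , _) {suc n} a =
    trans (additive _ _) (+-congˡ (linear-sum L (a ∘ suc)))

  δ : ∀ {n} → Fin n → Fin n → Carrier
  δ zero    zero    = 1#
  δ zero    (suc _) = 0#
  δ (suc _) zero    = 0#
  δ (suc j) (suc l) = δ j l

  ∑x*δ≈x : ∀ {n} (x : Fin n → Carrier) l → ∑[ j < n ] (x j * δ j l) ≈ x l
  ∑x*δ≈x {suc n} x zero = begin
    x zero * 1# +ᴿ ∑[ j < n ] (x (suc j) * 0#) ≈⟨ +-cong (*-identityʳ _) (sum-cong-≋ {n} (λ _ → zeroʳ _)) ⟩
    x zero +ᴿ ∑[ j < n ] 0#                    ≈⟨ +-congˡ (sum-replicate-zero n) ⟩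
    x zero +ᴿ 0#                               ≈⟨ +-identityʳ _ ⟩
    x zero                                     ∎
  ∑x*δ≈x {suc n} x (suc l) = begin
    x zero * 0# +ᴿ ∑[ j < n ] (x (suc j) * δ j l) ≈⟨ +-cong (zeroʳ _) (∑x*δ≈x (x ∘ suc) l) ⟩
    0# +ᴿ x (suc l)                               ≈⟨ +-identityˡ _ ⟩
    x (suc l)                                     ∎

  linear-expansion : ∀ {n f} → IsLinear R n f → ∀ x → f x ≈ ∑[ j < n ] (x j * f (δ j))
  linear-expansion {n} {f} L@(f-cong , _ , homogeneous) x = begin
    f x                                  ≈⟨ f-cong _ _ (λ l → ∑x*δ≈x x l) ⟨
    f (λ l → ∑[ j < n ] (x j * δ j l))   ≈⟨ linear-sum L (λ j l → x j * δ j l) ⟩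
    ∑[ j < n ] f (λ l → x j * δ j l)     ≈⟨ sum-cong-≋ {n} (λ j → homogeneous (x j) (δ j)) ⟩
    ∑[ j < n ] (x j * f (δ j))           ∎

  linear-maps-commute : ∀ {n m f g} → IsLinear R n f → IsLinear R m g →
    (x : Fin n → Fin m → Carrier) → g (λ k → f (λ j → x j k)) ≈ f (λ j → g (x j))
  linear-maps-commute {n} {m} {f} {g} f-linear g-linear@(g-cong , _ , homogeneous) x = begin
    g (λ k → f (λ j → x j k))               ≈⟨ g-cong _ _ (λ k → linear-expansion f-linear (λ j → x j k)) ⟩
    g (λ k → ∑[ j < n ] (x j k * f (δ j)))  ≈⟨ linear-sum g-linear (λ j k → x j k * f (δ j)) ⟩
    ∑[ j < n ] g (λ k → x j k * f (δ j))    ≈⟨ sum-cong-≋ {n} (λ j → g-cong _ _ (λ k → *-comm _ _)) ⟩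
    ∑[ j < n ] g (λ k → f (δ j) * x j k)    ≈⟨ sum-cong-≋ {n} (λ j → homogeneous _ _) ⟩
    ∑[ j < n ] (f (δ j) * g (x j))          ≈⟨ sum-cong-≋ {n} (λ j → *-comm _ _) ⟩
    ∑[ j < n ] (g (x j) * f (δ j))          ≈⟨ linear-expansion f-linear _ ⟨
    f (λ j → g (x j))                       ∎

  window : ∀ {N} d → (Fin N → ℕ → Carrier) → Fin N → ℕ → Fin (suc d) → Carrier
  window d u i n k = u i (n ∸ toℕ k)

  module _ {N d n₀ : ℕ} {u : Fin N → ℕ → Carrier} {f : Fin N → (Fin N → Carrier) → Carrier}
           (f-linear : ∀ i → IsLinear R N (f i))
           (recurrence : ∀ n → n₀ ≤ n → ∀ i → u i n ≈ f i (λ j → u j (n ∸ 1)))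
           where

    window-recurrence : ∀ {n} → n₀ + d ≤ n →
                        ∀ i k → window d u i (suc n) k ≈ f i (λ j → window d u j n k)
    window-recurrence {n} n₀+d≤n i k = begin
      u i (suc n ∸ toℕ k)                  ≈⟨ recurrence _ (n₀≤1+n∸k n₀+d≤n (toℕ≤pred[n] k)) i ⟩
      f i (λ j → u j (suc n ∸ toℕ k ∸ 1))  ≈⟨ proj₁ (f-linear i) _ _ (λ j →
                                                reflexive (≡.cong (u j) ([1+n∸k]∸1≡n∸k n (toℕ k)))) ⟩
      f i (λ j → u j (n ∸ toℕ k))          ∎

    g-window-recurrence : ∀ {g} → IsLinear R (suc d) g → ∀ {n} → n₀ + d ≤ n →
                          ∀ i → g (window d u i (suc n)) ≈ f i (λ j → g (window d u j n))
    g-window-recurrence {g} g-linear {n} n₀+d≤n i = begin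
      g (window d u i (suc n))                  ≈⟨ proj₁ g-linear _ _ (window-recurrence n₀+d≤n i) ⟩
      g (λ k → f i (λ j → window d u j n k))    ≈⟨ linear-maps-commute (f-linear i) g-linear _ ⟩
      f i (λ j → g (window d u j n))            ∎

    g-window-vanishing-propagates : ∀ {g} → IsLinear R (suc d) g →
      ∀ {n₁} → n₀ + d ≤ n₁ → (∀ i → g (window d u i n₁) ≈ 0#) →
      ∀ {n} → n₁ ≤′ n → ∀ i → g (window d u i n) ≈ 0#
    g-window-vanishing-propagates g-linear n₀+d≤n₁ vanishes ≤′-refl = vanishes
    g-window-vanishing-propagates {g} g-linear n₀+d≤n₁ vanishes (≤′-step {n} n₁≤′n) i = begin
      g (window d u i (suc n))        ≈⟨ g-window-recurrence g-linear (≤-trans n₀+d≤n₁ (≤′⇒≤ n₁≤′n)) i ⟩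
      f i (λ j → g (window d u j n))  ≈⟨ proj₁ (f-linear i) _ _
                                           (g-window-vanishing-propagates g-linear n₀+d≤n₁ vanishes n₁≤′n) ⟩
      f i (λ _ → 0#)                  ≈⟨ linear-zero (f-linear i) ⟩
      0#                              ∎

lemma3p3 : ∀ {c ℓ} (R : CommutativeRing c ℓ) →
    let open CommutativeRing R renaming (_+_ to _+ᴿ_) in
    (N d n₀ : ℕ) → 1 ≤ N → 1 ≤ d → 1 ≤ n₀ →
    (u : Fin N → ℕ → Carrier) →
    (f : Fin N → (Fin N → Carrier) → Carrier) →
    (∀ i → IsLinear R N (f i)) →
    (∀ n → n₀ ≤ n → ∀ i → u i n ≈ f i (λ j → u j (n ∸ 1))) →
    (g : (Fin (suc d) → Carrier) → Carrier) →
    IsLinear R (suc d) g →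
    (n₁ : ℕ) → n₀ + d ≤ n₁ →
    (∀ i → g (λ k → u i (n₁ ∸ toℕ k)) ≈ 0#) →
    ∀ n → n₁ ≤ n → ∀ i → g (λ k → u i (n ∸ toℕ k)) ≈ 0#
lemma3p3 R N d n₀ _ _ _ u f f-linear recurrence g g-linear n₁ n₀+d≤n₁ vanishes n n₁≤n =
  g-window-vanishing-propagates R f-linear recurrence g-linear n₀+d≤n₁ vanishes (≤⇒≤′ n₁≤n)
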